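{- Let $p$ be an odd prime and $q=p^m$ with $m\ge1$. Let $l,r,s,e$ be positive integers with $l\ge3$ odd, $\gcd(l,e)=1$, and $q-1=ls$. If $P(x)=x^r(x^{es}+1)$ is a permutation polynomial of $\mathbb{F}_q$, then $\gcd(r,s)=1$, $p\mid 2^s-1$, and $l\nmid 2r+es$.
   Context: A permutation polynomial of $\mathbb{F}_q$ is one inducing a bijection of $\mathbb{F}_q$. -}

module Defs where

open import Level using (0ℓ)
open import Data.Nat using (ℕ)
open import Data.Fin using (Fin)
open import Data.Product using (∃)
open import Relation.Nullary using (¬_)
open import Relation.Binary.PropositionalEquality as ≡ using ()
open import Algebra.Bundles using (CommutativeRing)
import Algebra.Bundles
import Algebra.Definitions.RawSemiring as RS
open import Function.Bundles using (Bijection)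
open import Function.Definitions using (Bijective)

record FiniteField (q : ℕ) : Set₁ where
  field
    commRing : CommutativeRing 0ℓ 0ℓ
  open CommutativeRing commRing public
  field
    0≉1     : ¬ (0# ≈ 1#)
    inverse : ∀ x → ¬ (x ≈ 0#) → ∃ λ y → x * y ≈ 1#
    enum    : Bijection (≡.setoid (Fin q)) setoid

  open RS (Algebra.Bundles.Semiring.rawSemiring semiring) public using (_^_)

P : ∀ {q} (F : FiniteField q) (r e s : ℕ) → FiniteField.Carrier F → FiniteField.Carrier F
P F r e s x = (x ^ r) * ((x ^ (e Data.Nat.* s)) + 1#)
  where open FiniteField F

IsPermutation : ∀ {q} (F : FiniteField q) → (FiniteField.Carrier F → FiniteField.Carrier F) → Set
IsPermutation F f = Bijective _≈_ _≈_ f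
  where open FiniteField F

module Submission where

-- If d > 1 divides r and s, a d-th root of unity ζ ≠ 1 has P ζ = 2 = P 1.
-- If l ∣ 2r + es, an l-th root of unity ζ ≠ 1 has P ζ⁻¹ = P ζ, so ζ² = 1, and ζ = 1 as l is odd.
-- Finally P(x)^s = f(x^s) with f y = y^r (y^e + 1)^s, and since gcd(r, s) = 1, f permutes the group
-- of nonzero s-th powers (the l-th roots of unity), as do y ↦ y² and y ↦ y^e. Multiplying f y over
-- this group gives ∏ y = (∏ y)^r (∏ (y + 1))^s, where ∏ y = 1 and ∏ (y + 1) = 2; hence 2^s = 1 in F,
-- that is p ∣ 2^s - 1.

open import Level using (_⊔_; 0ℓ)
open import Defs
open import Algebra.Bundles using (CommutativeMonoid)
open import Data.Nat as ℕ using (ℕ; zero; suc; _∸_)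
import Data.Nat.Properties as ℕ
open import Data.Fin as Fin using (Fin; punchIn; punchOut)
import Data.Fin.Properties as Fin
open import Data.Fin.Permutation using (Permutation; permutation)
open import Data.Product using (∃; _,_; proj₁; proj₂; _×_)
open import Data.Nat.Divisibility using (_∣_; _∣?_; divides; ∣-trans; n∣m*n; 0∣⇒≡0; 1∣_)
open import Data.Nat.GCD using (gcd; gcd[m,n]∣m; gcd[m,n]∣n; module Bézout)
open import Data.Nat.Primality using (Prime; prime⇒irreducible; prime[2])
open import Data.Sum using (inj₁; inj₂)
open import Data.Nat.Coprimality as Coprime using (Coprime; coprime-Bézout; gcd≡1⇒coprime)
open import Data.Vec using (Vec; []; _∷_)
open import Data.Vec.Relation.Unary.All as All using (All; []; _∷_)
open import Data.Empty using (⊥-elim)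
open import Function using (_∘_; id; case_of_)
open import Function.Bundles using (Bijection)
open import Function.Definitions using (Injective; Congruent)
open import Relation.Binary using (Setoid; _Respects_)
open import Relation.Binary.PropositionalEquality as ≡ using (_≡_; _≢_)
open import Relation.Nullary using (Dec; yes; no; ¬_; ¬?)
open import Relation.Nullary.Decidable using (_×-dec_; decidable-stable)
open import Relation.Unary using (Pred; Decidable; ∁; _∩_)
open import Relation.Unary.Properties using (∁?; _∩?_)

Fin-injective⇒surjective : ∀ {n} (f : Fin n → Fin n) → Injective _≡_ _≡_ f → ∀ y → ∃ λ x → f x ≡ y
Fin-injective⇒surjective {suc n} f f-injective y with Fin.any? (λ x → f x Fin.≟ y)
... | yes hit = hit
... | no miss = ⊥-elim (ℕ.<-irrefl ≡.refl (Fin.injective⇒≤ skip-y-injective))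
  where
  y≢f : ∀ x → y ≢ f x
  y≢f x y≡fx = miss (x , ≡.sym y≡fx)
  skip-y-injective : Injective _≡_ _≡_ (λ x → punchOut (y≢f x))
  skip-y-injective = f-injective ∘ Fin.punchOut-injective (y≢f _) (y≢f _)

Fin-injective⇒permutation : ∀ {n} (f : Fin n → Fin n) → Injective _≡_ _≡_ f → Permutation n n
Fin-injective⇒permutation f f-injective =
  permutation f (proj₁ ∘ surjective) (proj₂ ∘ surjective) (λ x → f-injective (proj₂ (surjective (f x))))
  where
  surjective : ∀ y → ∃ λ x → f x ≡ y
  surjective = Fin-injective⇒surjective f f-injective

prime∤⇒coprime : ∀ {p n} → Prime p → ¬ p ∣ n → Coprime p n
prime∤⇒coprime p-prime p∤n (d∣p , d∣n) with prime⇒irreducible p-prime d∣p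
... | inj₁ d≡1 = d≡1
... | inj₂ ≡.refl = ⊥-elim (p∤n d∣n)

module FiniteSetoid {a ℓa} (A : Setoid a ℓa) {n : ℕ} (enum : Bijection (≡.setoid (Fin (suc n))) A) where

  open Setoid A renaming (Carrier to Elem; _≈_ to _≃_)

  element : Fin (suc n) → Elem
  element = Bijection.to enum

  element-injective : Injective _≡_ _≃_ element
  element-injective = Bijection.injective enum

  index : Elem → Fin (suc n)
  index x = proj₁ (Bijection.surjective enum x)

  element-index : ∀ x → element (index x) ≃ x
  element-index x = proj₂ (Bijection.surjective enum x) ≡.refl

  index-injective : ∀ {x y} → index x ≡ index y → x ≃ y
  index-injective {x} {y} i≡j = trans (sym (element-index x)) (trans (reflexive (≡.cong element i≡j)) (element-index y))

  index-cong : ∀ {x y} → x ≃ y → index x ≡ index y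
  index-cong {x} {y} x≃y = element-injective (trans (element-index x) (trans x≃y (sym (element-index y))))

  infix 4 _≟_
  _≟_ : ∀ x y → Dec (x ≃ y)
  x ≟ y with index x Fin.≟ index y
  ... | yes i≡j = yes (index-injective i≡j)
  ... | no i≢j = no (i≢j ∘ index-cong)

  element-punchIn-≄ : ∀ a j → ¬ element (punchIn (index a) j) ≃ a
  element-punchIn-≄ a j ≃a = Fin.punchInᵢ≢i (index a) j (element-injective (trans ≃a (sym (element-index a))))

  ∃? : ∀ {p} {P : Pred Elem p} → P Respects _≃_ → Decidable P → Dec (∃ P)
  ∃? P-resp P? with Fin.any? (P? ∘ element)
  ... | yes (i , Pi) = yes (element i , Pi)
  ... | no none = no λ (x , Px) → none (index x , P-resp (sym (element-index x)) Px)

  record _Permutes_ {p} (σ : Elem → Elem) (S : Pred Elem p) : Set (a ⊔ ℓa ⊔ p) where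
    field
      maps-into : ∀ {x} → S x → S (σ x)
      injective-on : ∀ {x y} → S x → S y → σ x ≃ σ y → x ≃ y

module SubsetProduct {c ℓ} (M : CommutativeMonoid c ℓ)
  {a ℓa} (A : Setoid a ℓa) {n : ℕ} (enum : Bijection (≡.setoid (Fin (suc n))) A) where

  open CommutativeMonoid M renaming (_∙_ to _*_; ε to 1#; ∙-cong to *-cong; ∙-congˡ to *-congˡ;
    ∙-congʳ to *-congʳ; identityˡ to *-identityˡ; identityʳ to *-identityʳ)
  open import Algebra.Properties.CommutativeMonoid.Sum M
    using (sum-cong-≋; sum-remove; sum-permute; ∑-distrib-+; sum-replicate; sum-replicate-zero)
    renaming (sum to product)
  open import Algebra.Definitions.RawMonoid rawMonoid using () renaming (_×_ to _times_)
  open Setoid A using () renaming (Carrier to Elem; _≈_ to _≃_; sym to ≃-sym)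
  open FiniteSetoid A enum
  open import Relation.Binary.Reasoning.Setoid setoid

  infixr 8 _^_
  _^_ : Carrier → ℕ → Carrier
  x ^ m = m times x

  mask : ∀ {p} {P : Set p} → Dec P → Carrier → Carrier
  mask (yes _) x = x
  mask (no _) _ = 1#

  mask-yes : ∀ {p} {P : Set p} (d : Dec P) {x} → P → mask d x ≈ x
  mask-yes (yes _) _ = refl
  mask-yes (no ¬p) p = ⊥-elim (¬p p)

  mask-no : ∀ {p} {P : Set p} (d : Dec P) {x} → ¬ P → mask d x ≈ 1#
  mask-no (yes p) ¬p = ⊥-elim (¬p p)
  mask-no (no _) _ = refl

  mask-iff : ∀ {p q} {P : Set p} {Q : Set q} (d : Dec P) (d′ : Dec Q) {x} → (P → Q) → (Q → P) → mask d x ≈ mask d′ x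
  mask-iff (yes _) (yes _) _ _ = refl
  mask-iff (yes p) (no ¬q) p→q _ = ⊥-elim (¬q (p→q p))
  mask-iff (no ¬p) (yes q) _ q→p = ⊥-elim (¬p (q→p q))
  mask-iff (no _) (no _) _ _ = refl

  masked : ∀ {p} {S : Pred Elem p} → Decidable S → (Elem → Carrier) → Fin (suc n) → Carrier
  masked S? g i = mask (S? (element i)) (g (element i))

  ∏[_]_ : ∀ {p} {S : Pred Elem p} → Decidable S → (Elem → Carrier) → Carrier
  ∏[ S? ] g = product (masked S? g)

  ∏-const-except : ∀ a c → ∏[ ∁? (_≟ a) ] (λ _ → c) ≈ c ^ n
  ∏-const-except a c = begin
    ∏[ ∁? (_≟ a) ] (λ _ → c)                        ≈⟨ sum-remove h ⟩
    h (index a) * product (h ∘ punchIn (index a))   ≈⟨ *-cong h-at-a (sum-cong-≋ h-elsewhere) ⟩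
    1# * product {n} (λ _ → c)                      ≈⟨ *-identityˡ _ ⟩
    product {n} (λ _ → c)                           ≈⟨ sum-replicate n ⟩
    c ^ n                                           ∎
    where
    h : Fin (suc n) → Carrier
    h = masked (∁? (_≟ a)) (λ _ → c)
    h-at-a : h (index a) ≈ 1#
    h-at-a = mask-no (∁? (_≟ a) _) (λ ≄a → ≄a (element-index a))
    h-elsewhere : ∀ j → h (punchIn (index a) j) ≈ c
    h-elsewhere j = mask-yes (∁? (_≟ a) _) (element-punchIn-≄ a j)

  module _ {p} {S : Pred Elem p} (S? : Decidable S) where

    ∏-cong : ∀ {f g} → (∀ {x} → S x → f x ≈ g x) → ∏[ S? ] f ≈ ∏[ S? ] g
    ∏-cong {f} {g} f≈g = sum-cong-≋ (λ i → mask-cong (S? (element i)))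
      where
      mask-cong : ∀ {x} (d : Dec (S x)) → mask d (f x) ≈ mask d (g x)
      mask-cong (yes s) = f≈g s
      mask-cong (no _) = refl

    ∏-distrib : ∀ f g → ∏[ S? ] (λ x → f x * g x) ≈ ∏[ S? ] f * ∏[ S? ] g
    ∏-distrib f g = trans (sum-cong-≋ (λ i → mask-* (element i) (S? (element i)))) (∑-distrib-+ (masked S? f) (masked S? g))
      where
      mask-* : ∀ x (d : Dec (S x)) → mask d (f x * g x) ≈ mask d (f x) * mask d (g x)
      mask-* _ (yes _) = refl
      mask-* _ (no _) = sym (*-identityˡ 1#)

    ∏-1 : ∏[ S? ] (λ _ → 1#) ≈ 1#
    ∏-1 = trans (sum-cong-≋ (λ i → mask-1 (S? (element i)))) (sum-replicate-zero (suc n))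
      where
      mask-1 : ∀ {q} {Q : Set q} (d : Dec Q) → mask d 1# ≈ 1#
      mask-1 (yes _) = refl
      mask-1 (no _) = refl

    ∏-^ : ∀ f m → ∏[ S? ] (λ x → f x ^ m) ≈ (∏[ S? ] f) ^ m
    ∏-^ f zero = ∏-1
    ∏-^ f (suc m) = trans (∏-distrib f (λ x → f x ^ m)) (*-congˡ (∏-^ f m))

    ∏-closed : ∀ {q} (P : Pred Carrier q) → P 1# → (∀ {x y} → P x → P y → P (x * y)) →
               ∀ {f} → (∀ {x} → S x → P (f x)) → P (∏[ S? ] f)
    ∏-closed P P1 P* {f} Pf = product-closed (λ i → mask-closed (S? (element i)))
      where
      mask-closed : ∀ {x} (d : Dec (S x)) → P (mask d (f x))
      mask-closed (yes s) = Pf s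
      mask-closed (no _) = P1
      product-closed : ∀ {m} {t : Fin m → Carrier} → (∀ i → P (t i)) → P (product t)
      product-closed {zero} _ = P1
      product-closed {suc m} Pt = P* (Pt Fin.zero) (product-closed (Pt ∘ Fin.suc))

    module _ (S-resp : S Respects _≃_) {g : Elem → Carrier} (g-cong : Congruent _≃_ _≈_ g) where

      ∏-reindex : ∀ {σ} → σ Permutes S → ∏[ S? ] (g ∘ σ) ≈ ∏[ S? ] g
      ∏-reindex {σ} σ-permutes = begin
        ∏[ S? ] (g ∘ σ)                           ≈⟨ sum-cong-≋ (λ i → τ′-shift i (S? (element i))) ⟨
        product (λ i → h (τ′ i (S? (element i)))) ≈⟨ sum-permute h (Fin-injective⇒permutation _ τ-injective) ⟨
        ∏[ S? ] g                                 ∎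
        where
        open _Permutes_ σ-permutes
        h : Fin (suc n) → Carrier
        h = masked S? g
        S-index : ∀ {x} → S x → S (element (index x))
        S-index = S-resp (≃-sym (element-index _))
        τ′ : ∀ i → Dec (S (element i)) → Fin (suc n)
        τ′ i (yes _) = index (σ (element i))
        τ′ i (no _) = i
        τ′-shift : ∀ i (d : Dec (S (element i))) → h (τ′ i d) ≈ mask d (g (σ (element i)))
        τ′-shift i (yes s) = trans (mask-yes (S? _) (S-index (maps-into s))) (g-cong (element-index _))
        τ′-shift i (no ¬s) = mask-no (S? _) ¬s
        τ′-injective : ∀ i j di dj → τ′ i di ≡ τ′ j dj → i ≡ j
        τ′-injective i j (yes si) (yes sj) eq = element-injective (injective-on si sj (index-injective eq))
        τ′-injective i j (yes si) (no ¬sj) eq = ⊥-elim (¬sj (≡.subst (S ∘ element) eq (S-index (maps-into si))))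
        τ′-injective i j (no ¬si) (yes sj) eq = ⊥-elim (¬si (≡.subst (S ∘ element) (≡.sym eq) (S-index (maps-into sj))))
        τ′-injective i j (no _) (no _) eq = eq
        τ-injective : Injective _≡_ _≡_ (λ i → τ′ i (S? (element i)))
        τ-injective {i} {j} = τ′-injective i j (S? (element i)) (S? (element j))

      ∏-split : ∀ {a} → S a → ∏[ S? ] g ≈ g a * ∏[ S? ∩? ∁? (_≟ a) ] g
      ∏-split {a} Sa = begin
        ∏[ S? ] g                                              ≈⟨ sum-remove h ⟩
        h (index a) * product (h ∘ punchIn (index a))          ≈⟨ *-cong h-at-a (sum-cong-≋ h≈h′) ⟩
        g a * product (h′ ∘ punchIn (index a))                 ≈⟨ *-congˡ (*-identityˡ _) ⟨
        g a * (1# * product (h′ ∘ punchIn (index a)))          ≈⟨ *-congˡ (*-congʳ h′-at-a) ⟨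
        g a * (h′ (index a) * product (h′ ∘ punchIn (index a))) ≈⟨ *-congˡ (sum-remove h′) ⟨
        g a * ∏[ S? ∩? ∁? (_≟ a) ] g                           ∎
        where
        h h′ : Fin (suc n) → Carrier
        h = masked S? g
        h′ = masked (S? ∩? ∁? (_≟ a)) g
        h-at-a : h (index a) ≈ g a
        h-at-a = trans (mask-yes (S? _) (S-resp (≃-sym (element-index a)) Sa)) (g-cong (element-index a))
        h′-at-a : h′ (index a) ≈ 1#
        h′-at-a = mask-no ((S? ∩? ∁? (_≟ a)) _) (λ (_ , ≄a) → ≄a (element-index a))
        h≈h′ : ∀ j → h (punchIn (index a) j) ≈ h′ (punchIn (index a) j)
        h≈h′ j = mask-iff (S? _) ((S? ∩? ∁? (_≟ a)) _) (_, element-punchIn-≄ a j) proj₁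

module FiniteFieldProperties {k : ℕ} (F : FiniteField (suc k)) where

  open FiniteField F
  open FiniteSetoid setoid enum public
  open SubsetProduct *-commutativeMonoid setoid enum public hiding (_^_)
  open import Relation.Binary.Reasoning.Setoid setoid

  open import Algebra.Properties.Semiring.Exp semiring using (^-congˡ; ^-congʳ; ^-assocʳ)
  open import Algebra.Properties.CommutativeSemiring.Exp commutativeSemiring using (^-distrib-*)
  open import Algebra.Properties.Ring ring using (+-cancelʳ; +-identityʳ-unique; -‿distribˡ-*; x∙y⁻¹≈ε⇒x≈y)
  open import Algebra.Solver.Ring.NaturalCoefficients.Default commutativeSemiring

  1≉0 : 1# ≉ 0#
  1≉0 1≈0 = 0≉1 (sym 1≈0)

  *-cancelˡ : ∀ {x y z} → x ≉ 0# → x * y ≈ x * z → y ≈ z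
  *-cancelˡ {x} {y} {z} x≉0 xy≈xz with inverse x x≉0
  ... | x⁻¹ , xx⁻¹≈1 = begin
    y                ≈⟨ *-identityˡ y ⟨
    1# * y           ≈⟨ *-congʳ xx⁻¹≈1 ⟨
    (x * x⁻¹) * y    ≈⟨ solve 3 (λ x x⁻¹ y → (x :* x⁻¹) :* y := x⁻¹ :* (x :* y)) refl x x⁻¹ y ⟩
    x⁻¹ * (x * y)    ≈⟨ *-congˡ xy≈xz ⟩
    x⁻¹ * (x * z)    ≈⟨ solve 3 (λ x x⁻¹ z → (x :* x⁻¹) :* z := x⁻¹ :* (x :* z)) refl x x⁻¹ z ⟨
    (x * x⁻¹) * z    ≈⟨ *-congʳ xx⁻¹≈1 ⟩
    1# * z           ≈⟨ *-identityˡ z ⟩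
    z                ∎

  *-nonzero : ∀ {x y} → x ≉ 0# → y ≉ 0# → x * y ≉ 0#
  *-nonzero {x} x≉0 y≉0 xy≈0 = y≉0 (*-cancelˡ x≉0 (trans xy≈0 (sym (zeroʳ x))))

  *-cancelʳ : ∀ {x y z} → x ≉ 0# → y * x ≈ z * x → y ≈ z
  *-cancelʳ {x} {y} {z} x≉0 yx≈zx = *-cancelˡ x≉0 (trans (*-comm x y) (trans yx≈zx (*-comm z x)))

  idempotent⇒1 : ∀ {x} → x ≉ 0# → x ^ 2 ≈ x → x ≈ 1#
  idempotent⇒1 {x} x≉0 x²≈x = *-cancelˡ x≉0 (trans (sym (*-congˡ (*-identityʳ x))) (trans x²≈x (sym (*-identityʳ x))))

  inverse-unique : ∀ {x y z} → x * z ≈ 1# → y * z ≈ 1# → x ≈ y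
  inverse-unique {z = z} xz≈1 yz≈1 = *-cancelʳ z≉0 (trans xz≈1 (sym yz≈1))
    where
    z≉0 : z ≉ 0#
    z≉0 z≈0 = 1≉0 (trans (sym yz≈1) (trans (*-congˡ z≈0) (zeroʳ _)))

  c+a*0≈c : ∀ c a → c + a * 0# ≈ c
  c+a*0≈c c a = trans (+-congˡ (zeroʳ a)) (+-identityʳ c)

  factor-zero : ∀ {u v z} → u ≉ v → u * z ≈ v * z → z ≈ 0#
  factor-zero {z = z} u≉v uz≈vz with z ≟ 0#
  ... | yes z≈0 = z≈0
  ... | no z≉0 = ⊥-elim (u≉v (*-cancelʳ z≉0 uz≈vz))

  ^-nonzero : ∀ {x} n → x ≉ 0# → x ^ n ≉ 0#
  ^-nonzero zero x≉0 = 1≉0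
  ^-nonzero (suc n) x≉0 = *-nonzero x≉0 (^-nonzero n x≉0)

  0^n≈0 : ∀ {n} → 1 ℕ.≤ n → 0# ^ n ≈ 0#
  0^n≈0 (ℕ.s≤s _) = zeroˡ _

  1^n≈1 : ∀ n → 1# ^ n ≈ 1#
  1^n≈1 zero = refl
  1^n≈1 (suc n) = trans (*-identityˡ _) (1^n≈1 n)

  ^-comm : ∀ x m n → (x ^ m) ^ n ≈ (x ^ n) ^ m
  ^-comm x m n = trans (^-assocʳ x m n) (trans (^-congʳ x (ℕ.*-comm m n)) (sym (^-assocʳ x n m)))

  ^-root-of-unity : ∀ {w} m n → w ^ n ≈ 1# → (w ^ m) ^ n ≈ 1#
  ^-root-of-unity {w} m n wⁿ≈1 = trans (^-comm w m n) (trans (^-congˡ m wⁿ≈1) (1^n≈1 m))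

  root-of-unity-∣ : ∀ {w d m} → w ^ d ≈ 1# → d ∣ m → w ^ m ≈ 1#
  root-of-unity-∣ {w} {d} wᵈ≈1 (divides t ≡.refl) = trans (sym (^-assocʳ w t d)) (^-root-of-unity t d wᵈ≈1)

  ≉0-resp : (_≉ 0#) Respects _≈_
  ≉0-resp x≈y x≉0 y≈0 = x≉0 (trans x≈y y≈0)

  nonzero? : Decidable (_≉ 0#)
  nonzero? = ∁? (_≟ 0#)

  ∏-nonzero : ∀ {p} {S : Pred Carrier p} (S? : Decidable S) {f} → (∀ {x} → S x → f x ≉ 0#) → ∏[ S? ] f ≉ 0#
  ∏-nonzero S? = ∏-closed S? (_≉ 0#) 1≉0 *-nonzero

  *-permutes-nonzero : ∀ {c} → c ≉ 0# → (c *_) Permutes (_≉ 0#)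
  *-permutes-nonzero c≉0 = record { maps-into = *-nonzero c≉0 ; injective-on = λ _ _ → *-cancelˡ c≉0 }

  fermat : ∀ {x} → x ≉ 0# → x ^ k ≈ 1#
  fermat {x} x≉0 = *-cancelʳ (∏-nonzero nonzero? id) (begin
    x ^ k * ∏[ nonzero? ] id                    ≈⟨ *-congʳ (∏-const-except 0# x) ⟨
    ∏[ nonzero? ] (λ _ → x) * ∏[ nonzero? ] id  ≈⟨ ∏-distrib nonzero? (λ _ → x) id ⟨
    ∏[ nonzero? ] (x *_)                        ≈⟨ ∏-reindex nonzero? ≉0-resp id (*-permutes-nonzero x≉0) ⟩
    ∏[ nonzero? ] id                            ≈⟨ *-identityˡ _ ⟨
    1# * ∏[ nonzero? ] id                       ∎)

  -- Polynomials and roots of unity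

  eval : ∀ {n} → Vec Carrier n → Carrier → Carrier
  eval [] x = 0#
  eval (c ∷ cs) x = c + x * eval cs x

  quotient : ∀ {n} → Carrier → Vec Carrier (suc n) → Vec Carrier n
  quotient a (c ∷ []) = []
  quotient a (c ∷ c′ ∷ cs) = eval (c′ ∷ cs) a ∷ quotient a (c′ ∷ cs)

  -- p x - p a = (x - a) * quotient a p x, with both sides moved so that no subtraction occurs.
  eval-quotient : ∀ {n} a (p : Vec Carrier (suc n)) x →
                  eval p x + a * eval (quotient a p) x ≈ x * eval (quotient a p) x + eval p a
  eval-quotient a (c ∷ []) x =
    solve 4 (λ c x a z → (c :+ x :* z) :+ a :* z := x :* z :+ (c :+ a :* z)) refl c x a 0#
  eval-quotient a (c ∷ c′ ∷ cs) x = begin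
    (c + x * p′x) + a * (p′a + x * q′x)  ≈⟨ solve 6 (λ c x a p′x p′a q′x →
                                               (c :+ x :* p′x) :+ a :* (p′a :+ x :* q′x) :=
                                               (c :+ a :* p′a) :+ x :* (p′x :+ a :* q′x)) refl c x a p′x p′a q′x ⟩
    (c + a * p′a) + x * (p′x + a * q′x)  ≈⟨ +-congˡ (*-congˡ (eval-quotient a (c′ ∷ cs) x)) ⟩
    (c + a * p′a) + x * (x * q′x + p′a)  ≈⟨ solve 5 (λ c x a p′a q′x →
                                               (c :+ a :* p′a) :+ x :* (x :* q′x :+ p′a) :=
                                               x :* (p′a :+ x :* q′x) :+ (c :+ a :* p′a)) refl c x a p′a q′x ⟩
    x * (p′a + x * q′x) + (c + a * p′a)  ∎
    where
    p′x p′a q′x : Carrier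
    p′x = eval (c′ ∷ cs) x
    p′a = eval (c′ ∷ cs) a
    q′x = eval (quotient a (c′ ∷ cs)) x

  quotient-zero : ∀ {n} a (p : Vec Carrier (suc n)) → eval p a ≈ 0# →
                  All (_≈ 0#) (quotient a p) → All (_≈ 0#) p
  quotient-zero a (c ∷ []) pa≈0 [] = trans (sym (c+a*0≈c c a)) pa≈0 ∷ []
  quotient-zero a (c ∷ c′ ∷ cs) pa≈0 (p′a≈0 ∷ q′≈0) =
    trans (sym (c+a*0≈c c a)) (trans (+-congˡ (*-congˡ (sym p′a≈0))) pa≈0) ∷ quotient-zero a (c′ ∷ cs) p′a≈0 q′≈0

  vanishing-polynomial : ∀ {n} (p : Vec Carrier n) (a : Fin n → Carrier) → Injective _≡_ _≈_ a →
                         (∀ i → eval p (a i) ≈ 0#) → All (_≈ 0#) p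
  vanishing-polynomial [] _ _ _ = []
  vanishing-polynomial p@(_ ∷ _) a a-injective p∘a≈0 =
    quotient-zero a₀ p (p∘a≈0 Fin.zero)
      (vanishing-polynomial (quotient a₀ p) (a ∘ Fin.suc) (Fin.suc-injective ∘ a-injective) quotient-vanishes)
    where
    a₀ : Carrier
    a₀ = a Fin.zero
    quotient-vanishes : ∀ i → eval (quotient a₀ p) (a (Fin.suc i)) ≈ 0#
    quotient-vanishes i = factor-zero (λ a₀≈x → case a-injective a₀≈x of λ ()) (begin
      a₀ * q                 ≈⟨ +-identityˡ _ ⟨
      0# + a₀ * q            ≈⟨ +-congʳ (p∘a≈0 (Fin.suc i)) ⟨
      eval p x + a₀ * q      ≈⟨ eval-quotient a₀ p x ⟩
      x * q + eval p a₀      ≈⟨ +-congˡ (p∘a≈0 Fin.zero) ⟩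
      x * q + 0#             ≈⟨ +-identityʳ _ ⟩
      x * q                  ∎)
      where
      x q : Carrier
      x = a (Fin.suc i)
      q = eval (quotient a₀ p) x

  monomial : ∀ n → Vec Carrier (suc n)
  monomial zero = 1# ∷ []
  monomial (suc n) = 0# ∷ monomial n

  eval-monomial : ∀ n x → eval (monomial n) x ≈ x ^ n
  eval-monomial zero x = c+a*0≈c 1# x
  eval-monomial (suc n) x = trans (+-identityˡ _) (*-congˡ (eval-monomial n x))

  monomial≉0 : ∀ n → ¬ All (_≈ 0#) (monomial n)
  monomial≉0 zero (1≈0 ∷ []) = 1≉0 1≈0
  monomial≉0 (suc n) (_ ∷ rest) = monomial≉0 n rest

  roots-of-unity-bound : ∀ n (a : Fin (suc (suc n)) → Carrier) → Injective _≡_ _≈_ a → ¬ (∀ i → a i ^ suc n ≈ 1#)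
  roots-of-unity-bound n a a-injective roots =
    monomial≉0 n (All.tail (vanishing-polynomial (- 1# ∷ monomial n) a a-injective xⁿ⁺¹-1-vanishes))
    where
    xⁿ⁺¹-1-vanishes : ∀ i → eval (- 1# ∷ monomial n) (a i) ≈ 0#
    xⁿ⁺¹-1-vanishes i = begin
      - 1# + a i * eval (monomial n) (a i)  ≈⟨ +-congˡ (*-congˡ (eval-monomial n (a i))) ⟩
      - 1# + a i ^ suc n                     ≈⟨ +-congˡ (roots i) ⟩
      - 1# + 1#                              ≈⟨ -‿inverseˡ 1# ⟩
      0#                                     ∎

  nonzero-element : Fin k → Carrier
  nonzero-element = element ∘ punchIn (index 0#)

  nonzero-element-injective : Injective _≡_ _≈_ nonzero-element
  nonzero-element-injective = Fin.punchIn-injective (index 0#) _ _ ∘ element-injective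

  nonzero-element≉0 : ∀ j → nonzero-element j ≉ 0#
  nonzero-element≉0 = element-punchIn-≄ 0#

  k-nonZero : ℕ.NonZero k
  k-nonZero = Fin.nonZeroIndex (punchOut {i = index 0#} {j = index 1#} (0≉1 ∘ index-injective))

  NontrivialPower : ℕ → Pred Carrier 0ℓ
  NontrivialPower m x = x ≉ 0# × x ^ m ≉ 1#

  nontrivial-^? : ∀ m → Decidable (NontrivialPower m)
  nontrivial-^? m x = nonzero? x ×-dec ¬? (x ^ m ≟ 1#)

  nontrivial-^-resp : ∀ m → NontrivialPower m Respects _≈_
  nontrivial-^-resp m x≈y (x≉0 , xᵐ≉1) = ≉0-resp x≈y x≉0 , λ yᵐ≈1 → xᵐ≉1 (trans (^-congˡ m x≈y) yᵐ≈1)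

  nontrivial-root-of-unity : ∀ {d} → d ∣ k → 1 ℕ.< d → ∃ λ ζ → ζ ^ d ≈ 1# × ζ ≉ 1#
  nontrivial-root-of-unity (divides zero k≡0) _ = ⊥-elim (ℕ.≢-nonZero⁻¹ k {{k-nonZero}} k≡0)
  nontrivial-root-of-unity {d} (divides m@(suc m′) k≡m*d) 1<d with ∃? (nontrivial-^-resp m) (nontrivial-^? m)
  ... | yes (x , x≉0 , xᵐ≉1) = x ^ m , xᵐᵈ≈1 , xᵐ≉1
    where
    xᵐᵈ≈1 : (x ^ m) ^ d ≈ 1#
    xᵐᵈ≈1 = trans (^-assocʳ x m d) (trans (^-congʳ x (≡.sym k≡m*d)) (fermat x≉0))
  ... | no none = ⊥-elim (roots-of-unity-bound m′ a a-injective aᵐ≈1)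
    where
    m<k : m ℕ.< k
    m<k = ℕ.<-≤-trans (ℕ.m<m*n m d 1<d) (ℕ.≤-reflexive (≡.sym k≡m*d))
    a : Fin (suc m) → Carrier
    a = nonzero-element ∘ (λ t → Fin.inject≤ t m<k)
    a-injective : Injective _≡_ _≈_ a
    a-injective = Fin.inject≤-injective m<k m<k _ _ ∘ nonzero-element-injective
    aᵐ≈1 : ∀ t → a t ^ m ≈ 1#
    aᵐ≈1 t = decidable-stable (a t ^ m ≟ 1#) (λ aᵐ≉1 → none (a t , nonzero-element≉0 _ , aᵐ≉1))

  -- Powers with coprime exponents

  ^-bézout : ∀ {w a b} x y → 1 ℕ.+ y ℕ.* b ≡ x ℕ.* a → w ^ b ≈ 1# → (w ^ x) ^ a ≈ w
  ^-bézout {w} {a} {b} x y 1+yb≡xa wᵇ≈1 = begin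
    (w ^ x) ^ a          ≈⟨ ^-assocʳ w x a ⟩
    w ^ (x ℕ.* a)        ≈⟨ ^-congʳ w 1+yb≡xa ⟨
    w ^ (1 ℕ.+ y ℕ.* b)  ≈⟨ *-congˡ (^-assocʳ w y b) ⟨
    w * (w ^ y) ^ b      ≈⟨ *-congˡ (^-root-of-unity y b wᵇ≈1) ⟩
    w * 1#               ≈⟨ *-identityʳ w ⟩
    w                    ∎

  root-of-unity-bézout : ∀ {w a b} x y → 1 ℕ.+ y ℕ.* b ≡ x ℕ.* a → w ^ a ≈ 1# → w ^ b ≈ 1# → w ≈ 1#
  root-of-unity-bézout {a = a} x y 1+yb≡xa wᵃ≈1 wᵇ≈1 =
    trans (sym (^-bézout x y 1+yb≡xa wᵇ≈1)) (^-root-of-unity x a wᵃ≈1)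

  coprime-root-of-unity : ∀ {w a b} → Coprime a b → w ^ a ≈ 1# → w ^ b ≈ 1# → w ≈ 1#
  coprime-root-of-unity a⊥b wᵃ≈1 wᵇ≈1 with coprime-Bézout a⊥b
  ... | Bézout.+- x y 1+yb≡xa = root-of-unity-bézout x y 1+yb≡xa wᵃ≈1 wᵇ≈1
  ... | Bézout.-+ x y 1+xa≡yb = root-of-unity-bézout y x 1+xa≡yb wᵇ≈1 wᵃ≈1

  ratio-^ : ∀ {u v v⁻¹} n → v * v⁻¹ ≈ 1# → u ^ n ≈ v ^ n → (u * v⁻¹) ^ n ≈ 1#
  ratio-^ {u} {v} {v⁻¹} n vv⁻¹≈1 uⁿ≈vⁿ = begin
    (u * v⁻¹) ^ n     ≈⟨ ^-distrib-* u v⁻¹ n ⟩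
    u ^ n * v⁻¹ ^ n   ≈⟨ *-congʳ uⁿ≈vⁿ ⟩
    v ^ n * v⁻¹ ^ n   ≈⟨ ^-distrib-* v v⁻¹ n ⟨
    (v * v⁻¹) ^ n     ≈⟨ ^-congˡ n vv⁻¹≈1 ⟩
    1# ^ n            ≈⟨ 1^n≈1 n ⟩
    1#                ∎

  ratio-* : ∀ {u v v⁻¹} → v * v⁻¹ ≈ 1# → (u * v⁻¹) * v ≈ u
  ratio-* {u} {v} {v⁻¹} vv⁻¹≈1 = begin
    (u * v⁻¹) * v  ≈⟨ solve 3 (λ u v v⁻¹ → (u :* v⁻¹) :* v := u :* (v :* v⁻¹)) refl u v v⁻¹ ⟩
    u * (v * v⁻¹)  ≈⟨ *-congˡ vv⁻¹≈1 ⟩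
    u * 1#         ≈⟨ *-identityʳ u ⟩
    u              ∎

  ^-coprime-injective : ∀ {u v a b} → Coprime a b → v ≉ 0# → u ^ a ≈ v ^ a → u ^ b ≈ v ^ b → u ≈ v
  ^-coprime-injective {u} {v} {a} {b} a⊥b v≉0 uᵃ≈vᵃ uᵇ≈vᵇ with inverse v v≉0
  ... | v⁻¹ , vv⁻¹≈1 = begin
    u              ≈⟨ ratio-* vv⁻¹≈1 ⟨
    (u * v⁻¹) * v  ≈⟨ *-congʳ (coprime-root-of-unity a⊥b (ratio-^ a vv⁻¹≈1 uᵃ≈vᵃ)
                                                        (ratio-^ b vv⁻¹≈1 uᵇ≈vᵇ)) ⟩
    1# * v         ≈⟨ *-identityˡ v ⟩
    v              ∎

  -- Here w (w^x)^r = w^(ys) = 1, so the inverse ξ = (w^x)^(s-1) of w^x has ξ^r = w.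
  root-bézout⁻ : ∀ {w r} s x y → 1 ℕ.+ x ℕ.* r ≡ y ℕ.* s → w ^ s ≈ 1# → ∃ λ ξ → ξ ^ s ≈ 1# × ξ ^ r ≈ w
  root-bézout⁻ zero x y 1+xr≡y*0 _ = ⊥-elim (ℕ.1+n≢0 (≡.trans 1+xr≡y*0 (ℕ.*-zeroʳ y)))
  root-bézout⁻ {w} {r} s@(suc s′) x y 1+xr≡ys wˢ≈1 = ξ , ^-root-of-unity s′ s tˢ≈1 , inverse-unique ξʳtʳ≈1 wtʳ≈1
    where
    t : Carrier
    t = w ^ x
    tˢ≈1 : t ^ s ≈ 1#
    tˢ≈1 = ^-root-of-unity x s wˢ≈1
    ξ : Carrier
    ξ = t ^ s′
    ξʳtʳ≈1 : ξ ^ r * t ^ r ≈ 1#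
    ξʳtʳ≈1 = begin
      ξ ^ r * t ^ r  ≈⟨ ^-distrib-* ξ t r ⟨
      (ξ * t) ^ r    ≈⟨ ^-congˡ r (trans (*-comm ξ t) tˢ≈1) ⟩
      1# ^ r         ≈⟨ 1^n≈1 r ⟩
      1#             ∎
    wtʳ≈1 : w * t ^ r ≈ 1#
    wtʳ≈1 = begin
      w * (w ^ x) ^ r      ≈⟨ *-congˡ (^-assocʳ w x r) ⟩
      w ^ (1 ℕ.+ x ℕ.* r)  ≈⟨ ^-congʳ w 1+xr≡ys ⟩
      w ^ (y ℕ.* s)        ≈⟨ ^-assocʳ w y s ⟨
      (w ^ y) ^ s          ≈⟨ ^-root-of-unity y s wˢ≈1 ⟩
      1#                   ∎

  coprime-root : ∀ {w r s} → Coprime r s → w ^ s ≈ 1# → ∃ λ ξ → ξ ^ s ≈ 1# × ξ ^ r ≈ w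
  coprime-root {w} {r} {s} r⊥s wˢ≈1 with coprime-Bézout r⊥s
  ... | Bézout.+- x y 1+ys≡xr = w ^ x , ^-root-of-unity x s wˢ≈1 , ^-bézout x y 1+ys≡xr wˢ≈1
  ... | Bézout.-+ x y 1+xr≡ys = root-bézout⁻ s x y 1+xr≡ys wˢ≈1

  coprime-^-fibre : ∀ {u v r s} → Coprime r s → v ≉ 0# → u ^ s ≈ v ^ s → ∃ λ ξ → ξ ^ s ≈ 1# × u ≈ ξ ^ r * v
  coprime-^-fibre {u} {v} {r} {s} r⊥s v≉0 uˢ≈vˢ with inverse v v≉0
  ... | v⁻¹ , vv⁻¹≈1 with coprime-root r⊥s (ratio-^ s vv⁻¹≈1 uˢ≈vˢ)
  ... | ξ , ξˢ≈1 , ξʳ≈uv⁻¹ = ξ , ξˢ≈1 , trans (sym (ratio-* vv⁻¹≈1)) (*-congʳ (sym ξʳ≈uv⁻¹))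

  -- The characteristic

  open import Algebra.Properties.CommutativeMonoid.Sum +-commutativeMonoid
    using (sum; sum-cong-≋; sum-permute; ∑-distrib-+; sum-replicate)
  open import Algebra.Properties.Semiring.Mult semiring using (×1-homo-*) renaming (_×_ to _·_)

  card·1≈0 : suc k · 1# ≈ 0#
  card·1≈0 = +-identityʳ-unique (sum element) _ (sym (begin
    sum element                       ≈⟨ sum-permute element (Fin-injective⇒permutation τ τ-injective) ⟩
    sum (element ∘ τ)                 ≈⟨ sum-cong-≋ (λ i → element-index (element i + 1#)) ⟩
    sum (λ i → element i + 1#)        ≈⟨ ∑-distrib-+ element (λ _ → 1#) ⟩
    sum element + sum {suc k} (λ _ → 1#) ≈⟨ +-congˡ (sum-replicate (suc k)) ⟩
    sum element + suc k · 1#          ∎))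
    where
    τ : Fin (suc k) → Fin (suc k)
    τ i = index (element i + 1#)
    τ-injective : Injective _≡_ _≡_ τ
    τ-injective = element-injective ∘ +-cancelʳ 1# _ _ ∘ index-injective

  ·1-homo-^ : ∀ a m → (a ℕ.^ m) · 1# ≈ (a · 1#) ^ m
  ·1-homo-^ a zero = +-identityʳ 1#
  ·1-homo-^ a (suc m) = trans (×1-homo-* a (a ℕ.^ m)) (*-congˡ (·1-homo-^ a m))

  prime-power-char : ∀ {p m} → suc k ≡ p ℕ.^ m → p · 1# ≈ 0#
  prime-power-char {p} {m} q≡pᵐ = decidable-stable (p · 1# ≟ 0#) λ p·1≉0 →
    ^-nonzero m p·1≉0 (trans (sym (·1-homo-^ p m)) (trans (reflexive (≡.cong (_· 1#) (≡.sym q≡pᵐ))) card·1≈0))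

  ·1-bézout : ∀ {a b} x y → 1 ℕ.+ y ℕ.* b ≡ x ℕ.* a → a · 1# ≈ 0# → b · 1# ≉ 0#
  ·1-bézout {a} {b} x y 1+yb≡xa a·1≈0 b·1≈0 = 1≉0 (begin
    1#                          ≈⟨ +-identityʳ 1# ⟨
    1# + 0#                     ≈⟨ +-congˡ (trans (*-congˡ b·1≈0) (zeroʳ _)) ⟨
    1# + (y · 1#) * (b · 1#)    ≈⟨ +-congˡ (×1-homo-* y b) ⟨
    (1 ℕ.+ y ℕ.* b) · 1#        ≡⟨ ≡.cong (_· 1#) 1+yb≡xa ⟩
    (x ℕ.* a) · 1#              ≈⟨ ×1-homo-* x a ⟩
    (x · 1#) * (a · 1#)         ≈⟨ *-congˡ a·1≈0 ⟩
    (x · 1#) * 0#               ≈⟨ zeroʳ _ ⟩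
    0#                          ∎)

  char-∣ : ∀ {p n} → Prime p → p · 1# ≈ 0# → n · 1# ≈ 0# → p ∣ n
  char-∣ {p} {n} p-prime p·1≈0 n·1≈0 = decidable-stable (p ∣? n) λ p∤n →
    case coprime-Bézout (prime∤⇒coprime p-prime p∤n) of λ where
      (Bézout.+- x y 1+yn≡xp) → ·1-bézout x y 1+yn≡xp p·1≈0 n·1≈0
      (Bézout.-+ x y 1+xp≡yn) → ·1-bézout y x 1+xp≡yn n·1≈0 p·1≈0

  2^n·1≈2^n : ∀ n → (2 ℕ.^ n) · 1# ≈ (1# + 1#) ^ n
  2^n·1≈2^n n = trans (·1-homo-^ 2 n) (^-congˡ n (+-congˡ (+-identityʳ 1#)))

  ·1-∸1 : ∀ {n} → n · 1# ≈ 1# → (n ∸ 1) · 1# ≈ 0#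
  ·1-∸1 {zero} 0≈1 = ⊥-elim (0≉1 0≈1)
  ·1-∸1 {suc n} n·1≈1 = +-identityʳ-unique 1# (n · 1#) n·1≈1

  -- Products over sets permuted by squaring

  difference-of-squares : ∀ y → (1# - y) * (y + 1#) ≈ 1# - y ^ 2
  difference-of-squares y = begin
    (1# + - y) * (y + 1#)         ≈⟨ solve 2 (λ -y y → (con 1 :+ -y) :* (y :+ con 1) := (con 1 :+ -y :* y) :+ (y :+ -y))
                                             refl (- y) y ⟩
    (1# + - y * y) + (y + - y)    ≈⟨ +-cong (+-congˡ (sym (-‿distribˡ-* y y))) (-‿inverseʳ y) ⟩
    (1# + - (y * y)) + 0#         ≈⟨ +-identityʳ _ ⟩
    1# + - (y * y)                ≈⟨ +-congˡ (-‿cong (*-congˡ (*-identityʳ y))) ⟨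
    1# + - y ^ 2                  ∎

  module _ {p} {S : Pred Carrier p} (S? : Decidable S) (S-resp : S Respects _≈_) (squaring : (_^ 2) Permutes S) where
    open _Permutes_ squaring

    ∏-id≈1 : (∀ {y} → S y → y ≉ 0#) → ∏[ S? ] id ≈ 1#
    ∏-id≈1 S≉0 = idempotent⇒1 (∏-nonzero S? S≉0) (trans (sym (∏-^ S? id 2)) (∏-reindex S? S-resp id squaring))

    -- The factors 1 - y over y ≠ 1 are permuted by squaring, and (1 - y)(y + 1) = 1 - y², so ∏ (y + 1) over y ≠ 1 is 1.
    ∏-succ≈2 : S 1# → ∏[ S? ] (_+ 1#) ≈ 1# + 1#
    ∏-succ≈2 S1 = begin
      ∏[ S? ] (_+ 1#)              ≈⟨ ∏-split S? S-resp (λ x≈y → +-congʳ x≈y) S1 ⟩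
      (1# + 1#) * ∏[ S′? ] (_+ 1#)  ≈⟨ *-congˡ (*-cancelˡ (∏-nonzero S′? 1-y≉0) ∏′≈1) ⟩
      (1# + 1#) * 1#               ≈⟨ *-identityʳ _ ⟩
      1# + 1#                      ∎
      where
      S′ : Pred Carrier _
      S′ = S ∩ ∁ (_≈ 1#)
      S′? : Decidable S′
      S′? = S? ∩? ∁? (_≟ 1#)
      S′-resp : S′ Respects _≈_
      S′-resp x≈y (Sx , x≉1) = S-resp x≈y Sx , λ y≈1 → x≉1 (trans x≈y y≈1)
      squaring′ : (_^ 2) Permutes S′
      squaring′ = record
        { maps-into = λ (Sy , y≉1) → maps-into Sy , λ y²≈1 → y≉1 (injective-on Sy S1 (trans y²≈1 (sym (1^n≈1 2))))
        ; injective-on = λ (Sx , _) (Sy , _) → injective-on Sx Sy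
        }
      1-y≉0 : ∀ {y} → S′ y → 1# - y ≉ 0#
      1-y≉0 (_ , y≉1) 1-y≈0 = y≉1 (sym (x∙y⁻¹≈ε⇒x≈y 1# _ 1-y≈0))
      ∏′≈1 : ∏[ S′? ] (λ y → 1# - y) * ∏[ S′? ] (_+ 1#) ≈ ∏[ S′? ] (λ y → 1# - y) * 1#
      ∏′≈1 = begin
        ∏[ S′? ] (λ y → 1# - y) * ∏[ S′? ] (_+ 1#)     ≈⟨ ∏-distrib S′? (λ y → 1# - y) (_+ 1#) ⟨
        ∏[ S′? ] (λ y → (1# - y) * (y + 1#))   ≈⟨ ∏-cong S′? (λ {y} _ → difference-of-squares y) ⟩
        ∏[ S′? ] (λ y → 1# - y ^ 2)            ≈⟨ ∏-reindex S′? S′-resp (λ x≈y → +-congˡ (-‿cong x≈y)) squaring′ ⟩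
        ∏[ S′? ] (λ y → 1# - y)                       ≈⟨ *-identityʳ _ ⟨
        ∏[ S′? ] (λ y → 1# - y) * 1#                  ∎

  NonzeroPower : ℕ → Pred Carrier 0ℓ
  NonzeroPower s y = ∃ λ x → x ≉ 0# × x ^ s ≈ y

  module _ {s : ℕ} where

    nonzeroPower? : Decidable (NonzeroPower s)
    nonzeroPower? y = ∃? (λ x≈z (x≉0 , xˢ≈y) → ≉0-resp x≈z x≉0 , trans (^-congˡ s (sym x≈z)) xˢ≈y)
                         (λ x → nonzero? x ×-dec (x ^ s ≟ y))

    nonzeroPower-resp : NonzeroPower s Respects _≈_
    nonzeroPower-resp y≈z (x , x≉0 , xˢ≈y) = x , x≉0 , trans xˢ≈y y≈z

    nonzeroPower≉0 : ∀ {y} → NonzeroPower s y → y ≉ 0#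
    nonzeroPower≉0 (x , x≉0 , xˢ≈y) = ≉0-resp xˢ≈y (^-nonzero s x≉0)

    nonzeroPower-1 : NonzeroPower s 1#
    nonzeroPower-1 = 1# , 1≉0 , 1^n≈1 s

    module _ {l} (k≡ls : k ≡ l ℕ.* s) where

      nonzeroPower-root : ∀ {y} → NonzeroPower s y → y ^ l ≈ 1#
      nonzeroPower-root {y} (x , x≉0 , xˢ≈y) = begin
        y ^ l            ≈⟨ ^-congˡ l xˢ≈y ⟨
        (x ^ s) ^ l      ≈⟨ ^-comm x s l ⟩
        (x ^ l) ^ s      ≈⟨ ^-assocʳ x l s ⟩
        x ^ (l ℕ.* s)    ≈⟨ ^-congʳ x k≡ls ⟨
        x ^ k            ≈⟨ fermat x≉0 ⟩
        1#               ∎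

      ^-permutes-nonzeroPower : ∀ {a} → Coprime a l → (_^ a) Permutes NonzeroPower s
      ^-permutes-nonzeroPower {a} a⊥l = record
        { maps-into = λ (x , x≉0 , xˢ≈y) → x ^ a , ^-nonzero a x≉0 , trans (^-comm x a s) (^-congˡ a xˢ≈y)
        ; injective-on = λ y z yᵃ≈zᵃ → ^-coprime-injective a⊥l (nonzeroPower≉0 z) yᵃ≈zᵃ
                                         (trans (nonzeroPower-root y) (sym (nonzeroPower-root z)))
        }

module PermutationBinomial {k} (F : FiniteField (suc k)) (r e s : ℕ) where

  open FiniteField F
  open FiniteFieldProperties F
  open import Relation.Binary.Reasoning.Setoid setoid
  open import Algebra.Properties.Semiring.Exp semiring using (^-congˡ; ^-congʳ; ^-homo-*; ^-assocʳ)
  open import Algebra.Properties.CommutativeSemiring.Exp commutativeSemiring using (^-distrib-*)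
  open import Algebra.Solver.Ring.NaturalCoefficients.Default commutativeSemiring

  P′ : Carrier → Carrier
  P′ = P F r e s

  f : Carrier → Carrier
  f y = y ^ r * (y ^ e + 1#) ^ s

  f-cong : Congruent _≈_ _≈_ f
  f-cong x≈y = *-cong (^-congˡ r x≈y) (^-congˡ s (+-congʳ (^-congˡ e x≈y)))

  P^s≈f : ∀ x → P′ x ^ s ≈ f (x ^ s)
  P^s≈f x = begin
    (x ^ r * (x ^ (e ℕ.* s) + 1#)) ^ s       ≈⟨ ^-distrib-* _ _ s ⟩
    (x ^ r) ^ s * (x ^ (e ℕ.* s) + 1#) ^ s   ≈⟨ *-congʳ (^-comm x r s) ⟩
    (x ^ s) ^ r * (x ^ (e ℕ.* s) + 1#) ^ s   ≈⟨ *-congˡ (^-congˡ s (+-congʳ (^-assocʳ x e s))) ⟨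
    (x ^ s) ^ r * ((x ^ e) ^ s + 1#) ^ s     ≈⟨ *-congˡ (^-congˡ s (+-congʳ (^-comm x e s))) ⟩
    (x ^ s) ^ r * ((x ^ s) ^ e + 1#) ^ s     ∎

  P-root-of-unity : ∀ {ζ d} → ζ ^ d ≈ 1# → d ∣ r → d ∣ s → P′ ζ ≈ 1# + 1#
  P-root-of-unity {ζ} ζᵈ≈1 d∣r d∣s = begin
    ζ ^ r * (ζ ^ (e ℕ.* s) + 1#)  ≈⟨ *-cong (root-of-unity-∣ ζᵈ≈1 d∣r)
                                            (+-congʳ (root-of-unity-∣ ζᵈ≈1 (∣-trans d∣s (n∣m*n e)))) ⟩
    1# * (1# + 1#)                ≈⟨ *-identityˡ _ ⟩
    1# + 1#                       ∎

  P-twist : ∀ {ξ} x → ξ ^ s ≈ 1# → P′ (ξ * x) ≈ ξ ^ r * P′ x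
  P-twist {ξ} x ξˢ≈1 = begin
    (ξ * x) ^ r * ((ξ * x) ^ (e ℕ.* s) + 1#)         ≈⟨ *-cong (^-distrib-* ξ x r) (+-congʳ (^-distrib-* ξ x (e ℕ.* s))) ⟩
    (ξ ^ r * x ^ r) * (ξ ^ (e ℕ.* s) * x ^ (e ℕ.* s) + 1#)
                                                     ≈⟨ *-congˡ (+-congʳ (*-congʳ (root-of-unity-∣ ξˢ≈1 (n∣m*n e)))) ⟩
    (ξ ^ r * x ^ r) * (1# * x ^ (e ℕ.* s) + 1#)      ≈⟨ *-congˡ (+-congʳ (*-identityˡ _)) ⟩
    (ξ ^ r * x ^ r) * (x ^ (e ℕ.* s) + 1#)           ≈⟨ *-assoc _ _ _ ⟩
    ξ ^ r * (x ^ r * (x ^ (e ℕ.* s) + 1#))           ∎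

  -- With a = ζ^r and b = ζ^(es), the hypothesis says a²b = 1, whence η^r = ab and η^(es) = a²,
  -- and P η = ab(a² + 1) = a(b + 1) = P ζ.
  P-reflection : ∀ {ζ η} → ζ * η ≈ 1# → ζ ^ (2 ℕ.* r ℕ.+ e ℕ.* s) ≈ 1# → P′ η ≈ P′ ζ
  P-reflection {ζ} {η} ζη≈1 ζ²ʳ⁺ᵉˢ≈1 = begin
    η ^ r * (η ^ (e ℕ.* s) + 1#)   ≈⟨ *-cong ηʳ≈ab (+-congʳ ηᵉˢ≈aa) ⟩
    (a * b) * (a * a + 1#)         ≈⟨ solve 3 (λ a b o → (a :* b) :* (a :* a :+ o) := (a :* a :* b) :* a :+ (a :* b) :* o)
                                              refl a b 1# ⟩
    (a * a * b) * a + (a * b) * 1# ≈⟨ +-cong (trans (*-congʳ aab≈1) (*-identityˡ a)) (*-identityʳ _) ⟩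
    a + a * b                      ≈⟨ solve 2 (λ a b → a :+ a :* b := a :* (b :+ con 1)) refl a b ⟩
    a * (b + 1#)                   ∎
    where
    a b : Carrier
    a = ζ ^ r
    b = ζ ^ (e ℕ.* s)
    aab≈1 : a * a * b ≈ 1#
    aab≈1 = begin
      a * a * b                      ≈⟨ *-congʳ (*-congˡ (^-congʳ ζ (ℕ.+-identityʳ r))) ⟨
      a * ζ ^ (r ℕ.+ 0) * b          ≈⟨ *-congʳ (^-homo-* ζ r (r ℕ.+ 0)) ⟨
      ζ ^ (2 ℕ.* r) * b              ≈⟨ ^-homo-* ζ (2 ℕ.* r) (e ℕ.* s) ⟨
      ζ ^ (2 ℕ.* r ℕ.+ e ℕ.* s)      ≈⟨ ζ²ʳ⁺ᵉˢ≈1 ⟩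
      1#                             ∎
    η^n*ζ^n≈1 : ∀ n → η ^ n * ζ ^ n ≈ 1#
    η^n*ζ^n≈1 n = trans (sym (^-distrib-* η ζ n)) (trans (^-congˡ n (trans (*-comm η ζ) ζη≈1)) (1^n≈1 n))
    ηʳ≈ab : η ^ r ≈ a * b
    ηʳ≈ab = inverse-unique (η^n*ζ^n≈1 r) (trans (solve 2 (λ a b → (a :* b) :* a := a :* a :* b) refl a b) aab≈1)
    ηᵉˢ≈aa : η ^ (e ℕ.* s) ≈ a * a
    ηᵉˢ≈aa = inverse-unique (η^n*ζ^n≈1 (e ℕ.* s)) aab≈1

  module _ (P-permutes : IsPermutation F P′) where

    P-injective : ∀ {x y} → P′ x ≈ P′ y → x ≈ y
    P-injective = proj₁ P-permutes

    P-nonzero : 1 ℕ.≤ r → ∀ {x} → x ≉ 0# → P′ x ≉ 0#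
    P-nonzero 1≤r x≉0 Px≈0 = x≉0 (P-injective (trans Px≈0 (sym (trans (*-congʳ (0^n≈0 1≤r)) (zeroˡ _)))))

    common-divisor-trivial : ∀ {d} → s ∣ k → d ∣ r → d ∣ s → ¬ 1 ℕ.< d
    common-divisor-trivial s∣k d∣r d∣s 1<d with nontrivial-root-of-unity (∣-trans d∣s s∣k) 1<d
    ... | ζ , ζᵈ≈1 , ζ≉1 =
      ζ≉1 (P-injective (trans (P-root-of-unity ζᵈ≈1 d∣r d∣s) (sym P1≈2)))
      where
      P1≈2 : P′ 1# ≈ 1# + 1#
      P1≈2 = P-root-of-unity {d = 1} (*-identityʳ 1#) (1∣ r) (1∣ s)

    gcd≡1 : s ∣ k → 1 ℕ.≤ s → gcd r s ≡ 1
    gcd≡1 s∣k 1≤s with gcd r s | gcd[m,n]∣m r s | gcd[m,n]∣n r s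
    ... | 0 | _ | 0∣s = ⊥-elim (ℕ.<⇒≢ 1≤s (≡.sym (0∣⇒≡0 0∣s)))
    ... | 1 | _ | _ = ≡.refl
    ... | suc (suc _) | d∣r | d∣s = ⊥-elim (common-divisor-trivial s∣k d∣r d∣s (ℕ.s≤s (ℕ.s≤s ℕ.z≤n)))

    ∤2r+es : ∀ {l} → l ∣ k → 1 ℕ.< l → Coprime 2 l → ¬ l ∣ 2 ℕ.* r ℕ.+ e ℕ.* s
    ∤2r+es {suc l′} l∣k 1<l 2⊥l l∣2r+es with nontrivial-root-of-unity l∣k 1<l
    ... | ζ , ζˡ≈1 , ζ≉1 = ζ≉1 (coprime-root-of-unity 2⊥l ζ²≈1 ζˡ≈1)
      where
      η : Carrier
      η = ζ ^ l′
      η≈ζ : η ≈ ζ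
      η≈ζ = P-injective (P-reflection ζˡ≈1 (root-of-unity-∣ ζˡ≈1 l∣2r+es))
      ζ²≈1 : ζ ^ 2 ≈ 1#
      ζ²≈1 = trans (*-congˡ (trans (*-identityʳ ζ) (sym η≈ζ))) ζˡ≈1

    module _ (1≤r : 1 ℕ.≤ r) (r⊥s : Coprime r s) where

      -- P x = ξ^r P z = P (ξ z) for an s-th root of unity ξ, hence x = ξ z.
      P^s-injective : ∀ {x z} → z ≉ 0# → P′ x ^ s ≈ P′ z ^ s → x ^ s ≈ z ^ s
      P^s-injective {x} {z} z≉0 Pxˢ≈Pzˢ = twisted (coprime-^-fibre r⊥s (P-nonzero 1≤r z≉0) Pxˢ≈Pzˢ)
        where
        twisted : (∃ λ ξ → ξ ^ s ≈ 1# × P′ x ≈ ξ ^ r * P′ z) → x ^ s ≈ z ^ s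
        twisted (ξ , ξˢ≈1 , Px≈ξʳPz) = begin
          x ^ s              ≈⟨ ^-congˡ s (P-injective (trans Px≈ξʳPz (sym (P-twist z ξˢ≈1)))) ⟩
          (ξ * z) ^ s        ≈⟨ ^-distrib-* ξ z s ⟩
          ξ ^ s * z ^ s      ≈⟨ *-congʳ ξˢ≈1 ⟩
          1# * z ^ s         ≈⟨ *-identityˡ _ ⟩
          z ^ s              ∎

      P^s≈f-of : ∀ {x y} → x ^ s ≈ y → P′ x ^ s ≈ f y
      P^s≈f-of {x} xˢ≈y = trans (P^s≈f x) (f-cong xˢ≈y)

      f-permutes : f Permutes NonzeroPower s
      f-permutes = record { maps-into = maps-into ; injective-on = injective-on }
        where
        maps-into : ∀ {y} → NonzeroPower s y → NonzeroPower s (f y)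
        maps-into (x , x≉0 , xˢ≈y) = P′ x , P-nonzero 1≤r x≉0 , P^s≈f-of xˢ≈y
        injective-on : ∀ {y w} → NonzeroPower s y → NonzeroPower s w → f y ≈ f w → y ≈ w
        injective-on (x , _ , xˢ≈y) (z , z≉0 , zˢ≈w) fy≈fw =
          trans (sym xˢ≈y) (trans (P^s-injective z≉0 (trans (P^s≈f-of xˢ≈y) (trans fy≈fw (sym (P^s≈f-of zˢ≈w))))) zˢ≈w)

      2^s≈1 : ∀ {l} → k ≡ l ℕ.* s → Coprime e l → Coprime 2 l → (1# + 1#) ^ s ≈ 1#
      2^s≈1 k≡ls e⊥l 2⊥l = begin
        (1# + 1#) ^ s                       ≈⟨ *-identityˡ _ ⟨
        1# * (1# + 1#) ^ s                  ≈⟨ *-cong (1^n≈1 r) (^-congˡ s ∏[y+1]≈2) ⟨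
        1# ^ r * ∏[ S? ] (_+ 1#) ^ s        ≈⟨ *-cong (^-congˡ r ∏[y]≈1) (^-congˡ s ∏[yᵉ+1]≈∏[y+1]) ⟨
        ∏[ S? ] id ^ r * ∏[ S? ] (λ y → y ^ e + 1#) ^ s
                                            ≈⟨ *-cong (∏-^ S? id r) (∏-^ S? (λ y → y ^ e + 1#) s) ⟨
        ∏[ S? ] (_^ r) * ∏[ S? ] (λ y → (y ^ e + 1#) ^ s)
                                            ≈⟨ ∏-distrib S? (_^ r) (λ y → (y ^ e + 1#) ^ s) ⟨
        ∏[ S? ] f                           ≈⟨ ∏-reindex S? S-resp id f-permutes ⟩
        ∏[ S? ] id                          ≈⟨ ∏[y]≈1 ⟩
        1#                                  ∎
        where
        S? : Decidable (NonzeroPower s)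
        S? = nonzeroPower? {s}
        S-resp : NonzeroPower s Respects _≈_
        S-resp = nonzeroPower-resp {s}
        squaring : (_^ 2) Permutes NonzeroPower s
        squaring = ^-permutes-nonzeroPower k≡ls 2⊥l
        ∏[y]≈1 : ∏[ S? ] id ≈ 1#
        ∏[y]≈1 = ∏-id≈1 S? S-resp squaring (nonzeroPower≉0 {s})
        ∏[yᵉ+1]≈∏[y+1] : ∏[ S? ] (λ y → y ^ e + 1#) ≈ ∏[ S? ] (_+ 1#)
        ∏[yᵉ+1]≈∏[y+1] = ∏-reindex S? S-resp +-congʳ (^-permutes-nonzeroPower k≡ls e⊥l)
        ∏[y+1]≈2 : ∏[ S? ] (_+ 1#) ≈ 1# + 1#
        ∏[y+1]≈2 = ∏-succ≈2 S? S-resp squaring (nonzeroPower-1 {s})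

      p∣2^s∸1 : ∀ {p m l} → Prime p → suc k ≡ p ℕ.^ m → k ≡ l ℕ.* s → Coprime e l → Coprime 2 l →
                p ∣ 2 ℕ.^ s ∸ 1
      p∣2^s∸1 {p} {m} p-prime q≡pᵐ k≡ls e⊥l 2⊥l =
        char-∣ p-prime (prime-power-char {p} {m} q≡pᵐ) (·1-∸1 {2 ℕ.^ s} (trans (2^n·1≈2^n s) (2^s≈1 k≡ls e⊥l 2⊥l)))

FiniteField-empty : ¬ FiniteField 0
FiniteField-empty F with Bijection.surjective (FiniteField.enum F) (FiniteField.0# F)
... | () , _

open import Data.Nat using (_+_; _*_; _^_; _≤_)

theorem4p1 : (p m q l r s e : ℕ) → Prime p → ¬ (2 ∣ p) → 1 ≤ m → q ≡ p ^ m →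
    1 ≤ r → 1 ≤ s → 1 ≤ e → 3 ≤ l → ¬ (2 ∣ l) → gcd l e ≡ 1 → q ∸ 1 ≡ l * s →
    (F : FiniteField q) → IsPermutation F (P F r e s) →
    (gcd r s ≡ 1) × (p ∣ 2 ^ s ∸ 1) × ¬ (l ∣ 2 * r + e * s)
theorem4p1 _ _ zero _ _ _ _ _ _ _ _ _ _ _ _ _ _ _ F _ = ⊥-elim (FiniteField-empty F)
theorem4p1 p m (suc k) l r s e p-prime _ _ q≡pᵐ 1≤r 1≤s _ 3≤l 2∤l gcd[l,e]≡1 k≡ls F P-permutes =
  gcd[r,s]≡1 ,
  p∣2^s∸1 P-permutes 1≤r (gcd≡1⇒coprime gcd[r,s]≡1) {m = m} {l = l} p-prime q≡pᵐ k≡ls e⊥l 2⊥l ,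
  ∤2r+es P-permutes l∣k 1<l 2⊥l
  where
  open PermutationBinomial F r e s
  gcd[r,s]≡1 : gcd r s ≡ 1
  gcd[r,s]≡1 = gcd≡1 P-permutes (divides l k≡ls) 1≤s
  l∣k : l ∣ k
  l∣k = divides s (≡.trans k≡ls (ℕ.*-comm l s))
  1<l : 1 ℕ.< l
  1<l = ℕ.≤-trans (ℕ.n≤1+n 2) 3≤l
  e⊥l : Coprime e l
  e⊥l = Coprime.sym (gcd≡1⇒coprime gcd[l,e]≡1)
  2⊥l : Coprime 2 l
  2⊥l = prime∤⇒coprime prime[2] 2∤l
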